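{- Let $n$ be a positive integer. Then \[\sum_{\substack{\beta \in B_{2n}\\ \operatorname{fmaj}(\beta)\ \text{odd}}}(-1)^{\ell_B(\beta)}q^{\operatorname{fmaj}(\beta)}=0.\]
   Context: $B_m$ is the group of bijections $\beta$ of $[-m,m]\setminus\{0\}$ with $\beta(-i)=-\beta(i)$, written in window notation $\beta=[\beta_1,\dots,\beta_m]$ with $\beta_i=\beta(i)$. For $\beta\in B_m$: $\operatorname{inv}(\beta)=|\{(i,j): 1\le i<j\le m,\ \beta_i>\beta_j\}|$ (usual order on integers); $\operatorname{N}_1(\beta)=|\{i:\beta_i<0\}|$; $\operatorname{N}_2(\beta)=|\{\{i,j\}: i\neq j,\ \beta_i+\beta_j<0\}|$; the Coxeter length is $\ell_B(\beta)=\operatorname{inv}(\beta)+\operatorname{N}_1(\beta)+\operatorname{N}_2(\beta)$. The descent set $\operatorname{Des}(\beta)$ is the set of $i\in[m-1]$ with $\beta_i\succ\beta_{i+1}$, where $\prec$ is the total order $-1\prec-2\prec\cdots\prec-m\prec 1\prec 2\prec\cdots\prec m$; $\operatorname{maj}(\beta)=\sum_{i\in\operatorname{Des}(\beta)}i$ and $\operatorname{fmaj}(\beta)=2\operatorname{maj}(\beta)+\operatorname{N}_1(\beta)$. -}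

module Defs where

open import Data.Bool using (Bool; true; false; _∧_; not; if_then_else_)
open import Data.Nat as ℕ using (ℕ; zero; suc)
open import Data.Integer as ℤ using (ℤ; +_; -[1+_]; ∣_∣; _≤ᵇ_)
open import Data.List using (List; []; _∷_; map; _++_; upTo; concatMap; filterᵇ; sum; foldr)

-- Signed permutations β ∈ B_m are represented by their window
-- [β_1, …, β_m] : a list of m nonzero integers in [-m, m] whose absolute
-- values are pairwise distinct (equivalently: i ↦ |β_i| is a permutation
-- of [m]).  β(-i) = -β(i) is then determined.

entries : ℕ → List ℤ
entries m = map (λ i → -[1+ i ]) (upTo m) ++ map (λ i → + suc i) (upTo m)

words : ℕ → List ℤ → List (List ℤ)
words zero    xs = [] ∷ []
words (suc k) xs = concatMap (λ x → map (x ∷_) (words k xs)) xs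

notIn : ℕ → List ℤ → Bool
notIn a []       = true
notIn a (y ∷ ys) = not (a ℕ.≡ᵇ ∣ y ∣) ∧ notIn a ys

absDistinct : List ℤ → Bool
absDistinct []       = true
absDistinct (x ∷ xs) = notIn ∣ x ∣ xs ∧ absDistinct xs

B : ℕ → List (List ℤ)
B m = filterᵇ absDistinct (words m (entries m))

_<ℤᵇ_ : ℤ → ℤ → Bool
a <ℤᵇ b = not (b ≤ᵇ a)

isNeg : ℤ → Bool
isNeg x = x <ℤᵇ (+ 0)

countᵇ : {A : Set} → (A → Bool) → List A → ℕ
countᵇ p []       = 0
countᵇ p (x ∷ xs) = (if p x then 1 else 0) ℕ.+ countᵇ p xs

inv : List ℤ → ℕ
inv []       = 0
inv (x ∷ xs) = countᵇ (λ y → y <ℤᵇ x) xs ℕ.+ inv xs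

N₁ : List ℤ → ℕ
N₁ = countᵇ isNeg

N₂ : List ℤ → ℕ
N₂ []       = 0
N₂ (x ∷ xs) = countᵇ (λ y → isNeg (x ℤ.+ y)) xs ℕ.+ N₂ xs

ℓB : List ℤ → ℕ
ℓB w = inv w ℕ.+ N₁ w ℕ.+ N₂ w

-- the order -1 ≺ -2 ≺ … ≺ -m ≺ 1 ≺ 2 ≺ … ≺ m is realised by the key
-- key(-i) = i, key(i) = m + i  (for 1 ≤ i ≤ m)
key : ℕ → ℤ → ℕ
key m (+ i)      = m ℕ.+ i
key m -[1+ i ]   = suc i

succᵇ : ℕ → ℤ → ℤ → Bool
succᵇ m a b = key m b ℕ.<ᵇ key m a

-- sum of the positions i (1-indexed, starting the count at position p)
-- with w_i ≻ w_{i+1}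
majFrom : ℕ → ℕ → List ℤ → ℕ
majFrom m p []           = 0
majFrom m p (x ∷ [])     = 0
majFrom m p (x ∷ y ∷ ys) =
  (if succᵇ m x y then p else 0) ℕ.+ majFrom m (suc p) (y ∷ ys)

maj : ℕ → List ℤ → ℕ
maj m w = majFrom m 1 w

fmaj : ℕ → List ℤ → ℕ
fmaj m w = 2 ℕ.* maj m w ℕ.+ N₁ w

sgn : ℕ → ℤ
sgn zero    = + 1
sgn (suc k) = ℤ.- sgn k

oddᵇ : ℕ → Bool
oddᵇ zero    = false
oddᵇ (suc k) = not (oddᵇ k)

-- coefficient of q^k in  Σ_{β ∈ B_m, fmaj(β) odd} (-1)^{ℓ_B(β)} q^{fmaj(β)}
coeffOddFmaj : ℕ → ℕ → ℤ
coeffOddFmaj m k =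
  foldr ℤ._+_ (+ 0)
    (map (λ w → sgn (ℓB w))
      (filterᵇ (λ w → oddᵇ (fmaj m w) ∧ (fmaj m w ℕ.≡ᵇ k)) (B m)))

module Submission where

-- Read the window of β in consecutive position pairs (β₁,β₂), (β₃,β₄), …, and call such a
-- pair a domino when its entries have equal signs and absolute values {2j-1, 2j}.  Dominoes
-- contain an even number of negative entries and N₁ ≡ fmaj (mod 2) is odd, so some pair is not a
-- domino.  Let c be the absolute value of the first entry of the first non-domino pair, and
-- exchange the absolute values c and c ± 1 (its partner in {2j-1, 2j}), keeping all signs.
-- The two values are neighbours for ≺ within each sign class and never stand next to each
-- other with equal signs, so no descent moves and fmaj is unchanged; the first non-domino
-- pair is still the same, so the map is an involution.  Among all pairs of positions only
-- the one carrying c and c ± 1 changes its contribution to inv + N₂, so the parity of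
-- ℓ_B = inv + N₁ + N₂ flips, and the terms of the sum cancel in pairs.

open import Defs
open import Data.Nat using (ℕ; _≤_; _*_)
open import Data.Integer using (+_)
open import Relation.Binary.PropositionalEquality using (_≡_)

open import Algebra.Bundles using (CommutativeRing)
import Algebra.Properties.CommutativeSemigroup as CommutativeSemigroupProperties
open import Data.Bool using (Bool; true; false; _∧_; _∨_; not; _xor_; if_then_else_; T)
open import Data.Bool.ListAction using (any)
open import Data.Bool.Properties
  using ( xor-∧-commutativeRing; xor-assoc; xor-comm; xor-identityʳ; xor-same; not-involutive
        ; not-distribˡ-xor; ∧-comm; ∧-zeroʳ; ∧-identityʳ; ∧-conicalˡ; ∧-conicalʳ; ∨-zeroʳ; T-≡)
open import Data.Empty using (⊥-elim)
open import Data.Integer as ℤ using (ℤ; -[1+_]; -_; ∣_∣)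
open import Data.Integer.Properties as ℤP using ()
open import Data.List
  using (List; []; _∷_; _++_; map; concatMap; foldr; length; upTo; filterᵇ; cartesianProductWith)
open import Data.List.Properties
  using (length-removeAt′; length-upTo; length-map; ∷-injective; map-∘; map-cong-local; map-id-local)
open import Data.List.Membership.Propositional using (_∈_; _─_)
open import Data.List.Membership.Propositional.Properties
  using ( ∈-upTo⁺; ∈-upTo⁻; ∈-map⁺; ∈-map⁻; ∈-++⁺ˡ; ∈-++⁺ʳ; ∈-++⁻
        ; ∈-cartesianProductWith⁺; ∈-cartesianProductWith⁻; ∈-filter⁺; ∈-filter⁻)
open import Data.List.Relation.Binary.Subset.Propositional using (_⊆_)
open import Data.List.Relation.Unary.All as All using (All; []; _∷_)
open import Data.List.Relation.Unary.All.Properties as All using ()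
open import Data.List.Relation.Unary.AllPairs using (AllPairs; []; _∷_)
open import Data.List.Relation.Unary.AllPairs.Properties as AllPairs using ()
open import Data.List.Relation.Unary.Any using (here; there)
open import Data.List.Relation.Unary.Linked using (Linked; []; [-]; _∷_)
open import Data.List.Relation.Unary.Unique.Propositional using (Unique)
import Data.List.Relation.Unary.Unique.Propositional.Properties as Unique
open import Data.Maybe using (Maybe; just; nothing; maybe′)
open import Data.Nat as ℕ using (zero; suc; _+_; _<_; z≤n; s≤s; z<s; _≡ᵇ_; _<ᵇ_)
open import Data.Nat.Properties as ℕP using ()
open import Data.List.Membership.DecPropositional ℕ._≟_ using (_∈?_)
open import Data.Product using (_×_; _,_; proj₁; proj₂)
open import Data.Sum using (inj₁; inj₂)
open import Function using (_∘_; flip; case_of_)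
open import Function.Bundles using (Equivalence)
open import Relation.Binary.PropositionalEquality
  using (_≢_; refl; sym; trans; cong; cong₂; subst; module ≡-Reasoning)
open import Relation.Nullary using (yes; no)
open import Relation.Nullary.Decidable using (dec-true; dec-false; T?)

open import Algebra.Properties.AbelianGroup ℤP.+-0-abelianGroup using (\\-leftDividesˡ)
module ℤ+ = CommutativeSemigroupProperties ℤP.+-commutativeSemigroup
module ⊕ = CommutativeSemigroupProperties (CommutativeRing.+-commutativeSemigroup xor-∧-commutativeRing)

module _ {A : Set} where

  ∈-─⁻ : ∀ {xs : List A} {x y} (p : x ∈ xs) → y ∈ xs ─ p → y ∈ xs
  ∈-─⁻ (here _)  q         = there q
  ∈-─⁻ (there p) (here e)  = here e
  ∈-─⁻ (there p) (there q) = there (∈-─⁻ p q)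

  ∈-─⁺ : ∀ {xs : List A} {x y} (p : x ∈ xs) → y ∈ xs → y ≢ x → y ∈ xs ─ p
  ∈-─⁺ (here refl) (here e)  y≢x = ⊥-elim (y≢x e)
  ∈-─⁺ (here refl) (there q) _   = q
  ∈-─⁺ (there p)   (here e)  _   = here e
  ∈-─⁺ (there p)   (there q) y≢x = there (∈-─⁺ p q y≢x)

  Unique-─ : ∀ {xs : List A} {x} (p : x ∈ xs) → Unique xs → Unique (xs ─ p)
  Unique-─ (here _)  (_ ∷ u)     = u
  Unique-─ (there p) (y∉xs ∷ u) = All.tabulate (λ q → All.lookup y∉xs (∈-─⁻ p q)) ∷ Unique-─ p u

  ∈-─⇒≢ : ∀ {xs : List A} {x y} (p : x ∈ xs) → Unique xs → y ∈ xs ─ p → y ≢ x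
  ∈-─⇒≢ (here refl) (x∉xs ∷ _) q refl         = All.lookup x∉xs q refl
  ∈-─⇒≢ (there p)   (z∉xs ∷ _) (here refl) refl = All.lookup z∉xs p refl
  ∈-─⇒≢ (there p)   (_ ∷ u)    (there q)        = ∈-─⇒≢ p u q

  length-≤-⊆ : ∀ {xs ys : List A} → Unique xs → xs ⊆ ys → length xs ≤ length ys
  length-≤-⊆ {[]}     _          _     = z≤n
  length-≤-⊆ {x ∷ xs} {ys} (x∉xs ∷ u) xs⊆ys = begin
    suc (length xs)        ≤⟨ s≤s (length-≤-⊆ u xs⊆ys─p) ⟩
    suc (length (ys ─ p))  ≡⟨ length-removeAt′ ys _ ⟨
    length ys              ∎
    where
    open ℕP.≤-Reasoning
    p = xs⊆ys (here refl)
    xs⊆ys─p : xs ⊆ ys ─ p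
    xs⊆ys─p y∈xs = ∈-─⁺ p (xs⊆ys (there y∈xs)) λ { refl → All.lookup x∉xs y∈xs refl }

unique-full⇒∈ : ∀ {m is} → Unique is → All (_< m) is → length is ≡ m → ∀ {j} → j < m → j ∈ is
unique-full⇒∈ {m} {is} u bounded len {j} j<m with j ∈? is
... | yes j∈is = j∈is
... | no  j∉is = ⊥-elim (ℕP.<-irrefl refl (begin
  suc m                  ≡⟨ cong suc len ⟨
  length (j ∷ is)        ≤⟨ length-≤-⊆ (j∉is′ ∷ u) j∷is⊆upTo ⟩
  length (upTo m)        ≡⟨ length-upTo m ⟩
  m                      ∎))
  where
  open ℕP.≤-Reasoning
  j∉is′ : All (j ≢_) is
  j∉is′ = All.tabulate (λ { i∈is refl → j∉is i∈is })
  j∷is⊆upTo : j ∷ is ⊆ upTo m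
  j∷is⊆upTo (here refl) = ∈-upTo⁺ j<m
  j∷is⊆upTo (there i∈is) = ∈-upTo⁺ (All.lookup bounded i∈is)

concatMap≡cartesianProductWith : ∀ {A B C : Set} (f : A → B → C) xs ys →
  concatMap (λ x → map (f x) ys) xs ≡ cartesianProductWith f xs ys
concatMap≡cartesianProductWith f []       ys = refl
concatMap≡cartesianProductWith f (x ∷ xs) ys = cong (map (f x) ys ++_) (concatMap≡cartesianProductWith f xs ys)

-- Sums over a sign-reversing involution

sumℤ : List ℤ → ℤ
sumℤ = foldr ℤ._+_ (+ 0)

i≡-i⇒i≡0 : ∀ {i} → i ≡ - i → i ≡ + 0
i≡-i⇒i≡0 {+ zero}  _  = refl
i≡-i⇒i≡0 {+ suc _} ()
i≡-i⇒i≡0 { -[1+ _ ]} ()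

module _ {A : Set} (g : A → ℤ) (φ : A → A) where

  IsSignReversingInvolutionOn : List A → Set
  IsSignReversingInvolutionOn xs = ∀ {x} → x ∈ xs → φ x ∈ xs × φ (φ x) ≡ x × g (φ x) ≡ - g x

  sum-─ : ∀ {xs x} (p : x ∈ xs) → sumℤ (map g xs) ≡ g x ℤ.+ sumℤ (map g (xs ─ p))
  sum-─ (here refl) = refl
  sum-─ {z ∷ xs} {x} (there p) = trans (cong (λ v → g z ℤ.+ v) (sum-─ p)) (ℤ+.x∙yz≈y∙xz (g z) (g x) _)

  private
    -- A fixed point of φ has weight 0; any other x is removed together with φ x.
    sum≡0 : ∀ n xs → length xs ≤ n → Unique xs → IsSignReversingInvolutionOn xs → sumℤ (map g xs) ≡ + 0
    sum≡0 _ [] _ _ _ = refl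
    sum≡0 (suc n) (x ∷ xs) (s≤s len) (x∉xs ∷ u) inv with inv (here refl)
    ... | here φx≡x , _ , gφx≡-gx = cong₂ ℤ._+_ gx≡0 (sum≡0 n xs len u inv′)
      where
      gx≡0 : g x ≡ + 0
      gx≡0 = i≡-i⇒i≡0 (trans (cong g (sym φx≡x)) gφx≡-gx)
      inv′ : IsSignReversingInvolutionOn xs
      inv′ {y} y∈xs with inv (there y∈xs)
      ... | here φy≡x , φφy≡y , _ =
        ⊥-elim (All.lookup x∉xs y∈xs (trans (sym φx≡x) (trans (cong φ (sym φy≡x)) φφy≡y)))
      ... | there φy∈xs , rest = φy∈xs , rest
    ... | there p , φφx≡x , gφx≡-gx = begin
      g x ℤ.+ sumℤ (map g xs)                      ≡⟨ cong (λ v → g x ℤ.+ v) (sum-─ p) ⟩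
      g x ℤ.+ (g (φ x) ℤ.+ sumℤ (map g (xs ─ p)))
        ≡⟨ cong (λ v → g x ℤ.+ (v ℤ.+ sumℤ (map g (xs ─ p)))) gφx≡-gx ⟩
      g x ℤ.+ (- g x ℤ.+ sumℤ (map g (xs ─ p)))    ≡⟨ \\-leftDividesˡ (g x) _ ⟩
      sumℤ (map g (xs ─ p))                        ≡⟨ sum≡0 n (xs ─ p) len′ (Unique-─ p u) inv′ ⟩
      + 0                                          ∎
      where
      open ≡-Reasoning
      len′ : length (xs ─ p) ≤ n
      len′ = ℕP.≤-trans (ℕP.n≤1+n _) (subst (_≤ n) (length-removeAt′ xs _) len)
      inv′ : IsSignReversingInvolutionOn (xs ─ p)
      inv′ {y} y∈xs─p with y∈xs ← ∈-─⁻ p y∈xs─p | inv (there y∈xs)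
      ... | here φy≡x , φφy≡y , _ = ⊥-elim (∈-─⇒≢ p u y∈xs─p (trans (sym φφy≡y) (cong φ φy≡x)))
      ... | there φy∈xs , φφy≡y , gφy≡-gy = ∈-─⁺ p φy∈xs φy≢φx , φφy≡y , gφy≡-gy
        where
        φy≢φx : φ y ≢ φ x
        φy≢φx φy≡φx = All.lookup x∉xs y∈xs (trans (sym φφx≡x) (trans (cong φ (sym φy≡φx)) φφy≡y))

  sum≡0-of-sign-reversing-involution : ∀ {xs} → Unique xs → IsSignReversingInvolutionOn xs →
    sumℤ (map g xs) ≡ + 0
  sum≡0-of-sign-reversing-involution {xs} = sum≡0 (length xs) xs ℕP.≤-refl

oddᵇ-+ : ∀ a b → oddᵇ (a + b) ≡ oddᵇ a xor oddᵇ b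
oddᵇ-+ zero    b = refl
oddᵇ-+ (suc a) b = trans (cong not (oddᵇ-+ a b)) (not-distribˡ-xor (oddᵇ a) (oddᵇ b))

oddᵇ-2*+ : ∀ a b → oddᵇ (2 * a + b) ≡ oddᵇ b
oddᵇ-2*+ a b = begin
  oddᵇ (2 * a + b)                        ≡⟨ oddᵇ-+ (2 * a) b ⟩
  oddᵇ (a + (a + 0)) xor oddᵇ b           ≡⟨ cong (λ k → oddᵇ (a + k) xor oddᵇ b) (ℕP.+-identityʳ a) ⟩
  oddᵇ (a + a) xor oddᵇ b                 ≡⟨ cong (_xor oddᵇ b) (trans (oddᵇ-+ a a) (xor-same (oddᵇ a))) ⟩
  oddᵇ b                                  ∎
  where open ≡-Reasoning

sgn≡ : ∀ k → sgn k ≡ (if oddᵇ k then -[1+ 0 ] else + 1)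
sgn≡ zero = refl
sgn≡ (suc k) with oddᵇ k | sgn≡ k
... | true  | e = cong -_ e
... | false | e = cong -_ e

sgn-opposite : ∀ a b → oddᵇ a ≡ not (oddᵇ b) → sgn a ≡ - sgn b
sgn-opposite a b a≢b rewrite sgn≡ a | sgn≡ b | a≢b with oddᵇ b
... | true  = refl
... | false = refl

module _ {A : Set} where

  pairCount : (A → A → Bool) → List A → ℕ
  pairCount f []       = 0
  pairCount f (x ∷ xs) = countᵇ (f x) xs + pairCount f xs

  oddᵇ-countᵇ-∷ : ∀ p (x : A) xs → oddᵇ (countᵇ p (x ∷ xs)) ≡ p x xor oddᵇ (countᵇ p xs)
  oddᵇ-countᵇ-∷ p x xs with p x
  ... | true  = refl
  ... | false = refl

  oddᵇ-countᵇ-xor : ∀ p q xs →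
    oddᵇ (countᵇ (λ y → p y xor q y) xs) ≡ oddᵇ (countᵇ p xs) xor oddᵇ (countᵇ q xs)
  oddᵇ-countᵇ-xor p q []       = refl
  oddᵇ-countᵇ-xor p q (x ∷ xs) = begin
    oddᵇ (countᵇ (λ y → p y xor q y) (x ∷ xs))
      ≡⟨ oddᵇ-countᵇ-∷ (λ y → p y xor q y) x xs ⟩
    (p x xor q x) xor oddᵇ (countᵇ (λ y → p y xor q y) xs)
      ≡⟨ cong ((p x xor q x) xor_) (oddᵇ-countᵇ-xor p q xs) ⟩
    (p x xor q x) xor (oddᵇ (countᵇ p xs) xor oddᵇ (countᵇ q xs))
      ≡⟨ ⊕.interchange (p x) (q x) (oddᵇ (countᵇ p xs)) (oddᵇ (countᵇ q xs)) ⟩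
    (p x xor oddᵇ (countᵇ p xs)) xor (q x xor oddᵇ (countᵇ q xs))
      ≡⟨ cong₂ _xor_ (oddᵇ-countᵇ-∷ p x xs) (oddᵇ-countᵇ-∷ q x xs) ⟨
    oddᵇ (countᵇ p (x ∷ xs)) xor oddᵇ (countᵇ q (x ∷ xs))
      ∎
    where open ≡-Reasoning

  oddᵇ-pairCount-xor : ∀ f h xs →
    oddᵇ (pairCount (λ x y → f x y xor h x y) xs) ≡ oddᵇ (pairCount f xs) xor oddᵇ (pairCount h xs)
  oddᵇ-pairCount-xor f h []       = refl
  oddᵇ-pairCount-xor f h (x ∷ xs) = begin
    oddᵇ (countᵇ (λ y → f x y xor h x y) xs + pairCount (λ x y → f x y xor h x y) xs)
      ≡⟨ oddᵇ-+ (countᵇ (λ y → f x y xor h x y) xs) (pairCount (λ x y → f x y xor h x y) xs) ⟩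
    oddᵇ (countᵇ (λ y → f x y xor h x y) xs) xor oddᵇ (pairCount (λ x y → f x y xor h x y) xs)
      ≡⟨ cong₂ _xor_ (oddᵇ-countᵇ-xor (f x) (h x) xs) (oddᵇ-pairCount-xor f h xs) ⟩
    (cf xor ch) xor (pf xor ph)  ≡⟨ ⊕.interchange cf ch pf ph ⟩
    (cf xor pf) xor (ch xor ph)  ≡⟨ cong₂ _xor_ (oddᵇ-+ (countᵇ (f x) xs) _) (oddᵇ-+ (countᵇ (h x) xs) _) ⟨
    oddᵇ (pairCount f (x ∷ xs)) xor oddᵇ (pairCount h (x ∷ xs))
      ∎
    where
    open ≡-Reasoning
    cf = oddᵇ (countᵇ (f x) xs)
    ch = oddᵇ (countᵇ (h x) xs)
    pf = oddᵇ (pairCount f xs)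
    ph = oddᵇ (pairCount h xs)

  countᵇ-cong : ∀ {p q} {xs : List A} → All (λ y → p y ≡ q y) xs → countᵇ p xs ≡ countᵇ q xs
  countᵇ-cong []       = refl
  countᵇ-cong (e ∷ es) = cong₂ (λ b n → (if b then 1 else 0) + n) e (countᵇ-cong es)

  pairCount-cong : ∀ {f h} {P : A → Set} {R : A → A → Set} {xs} → All P xs → AllPairs R xs →
    (∀ {x y} → P x → P y → R x y → f x y ≡ h x y) → pairCount f xs ≡ pairCount h xs
  pairCount-cong []         []           _  = refl
  pairCount-cong (px ∷ pxs) (rx ∷ rxs) eq =
    cong₂ _+_ (countᵇ-cong (All.zipWith (λ (py , rxy) → eq px py rxy) (pxs , rx)))
              (pairCount-cong pxs rxs eq)

module _ {A B : Set} (h : B → A) where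

  countᵇ-map : ∀ p xs → countᵇ p (map h xs) ≡ countᵇ (λ y → p (h y)) xs
  countᵇ-map p []       = refl
  countᵇ-map p (x ∷ xs) = cong (λ n → (if p (h x) then 1 else 0) + n) (countᵇ-map p xs)

  pairCount-map : ∀ f xs → pairCount f (map h xs) ≡ pairCount (λ x y → f (h x) (h y)) xs
  pairCount-map f []       = refl
  pairCount-map f (x ∷ xs) = cong₂ _+_ (countᵇ-map (f (h x)) xs) (pairCount-map f xs)

≡ᵇ-true : ∀ {i j} → i ≡ j → (i ≡ᵇ j) ≡ true
≡ᵇ-true {i} {j} = dec-true (i ℕ.≟ j)

≡ᵇ-false : ∀ {i j} → i ≢ j → (i ≡ᵇ j) ≡ false
≡ᵇ-false {i} {j} = dec-false (i ℕ.≟ j)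

<ᵇ-true : ∀ {a b} → a < b → (a <ᵇ b) ≡ true
<ᵇ-true {zero}  {suc b} _         = refl
<ᵇ-true {suc a} {suc b} (s≤s a<b) = <ᵇ-true a<b

<ᵇ-false : ∀ {a b} → b ≤ a → (a <ᵇ b) ≡ false
<ᵇ-false {a}     {zero}  _         = refl
<ᵇ-false {suc a} {suc b} (s≤s b≤a) = <ᵇ-false b≤a

<ᵇ-asym : ∀ {i j} → i ≢ j → (i <ᵇ j) ≡ not (j <ᵇ i)
<ᵇ-asym {zero}  {zero}  i≢j = ⊥-elim (i≢j refl)
<ᵇ-asym {zero}  {suc j} _   = refl
<ᵇ-asym {suc i} {zero}  _   = refl
<ᵇ-asym {suc i} {suc j} i≢j = <ᵇ-asym (i≢j ∘ cong suc)

not-<ᵇ-suc : ∀ i j → not (i <ᵇ suc j) ≡ (j <ᵇ i)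
not-<ᵇ-suc zero    j       = refl
not-<ᵇ-suc (suc i) zero    = refl
not-<ᵇ-suc (suc i) (suc j) = not-<ᵇ-suc i j

not-≤ᵇ : ∀ j i → not (j ℕ.≤ᵇ i) ≡ (i <ᵇ j)
not-≤ᵇ zero    i = refl
not-≤ᵇ (suc j) i = trans (cong not (sym (not-<ᵇ-suc i j))) (not-involutive (i <ᵇ suc j))

+-<ᵇ : ∀ m a b → (m + a <ᵇ m + b) ≡ (a <ᵇ b)
+-<ᵇ zero    a b = refl
+-<ᵇ (suc m) a b = +-<ᵇ m a b

isNeg-⊖ : ∀ a b → isNeg (a ℤ.⊖ b) ≡ (a <ᵇ b)
isNeg-⊖ zero    zero    = refl
isNeg-⊖ zero    (suc b) = refl
isNeg-⊖ (suc a) zero    = refl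
isNeg-⊖ (suc a) (suc b) = trans (cong isNeg (ℤP.[1+m]⊖[1+n]≡m⊖n a b)) (isNeg-⊖ a b)

-- The pairing 2k ↔ 2k+1 of indices and the transposition it induces

partner : ℕ → ℕ
partner zero          = 1
partner (suc zero)    = 0
partner (suc (suc i)) = suc (suc (partner i))

partner-involutive : ∀ i → partner (partner i) ≡ i
partner-involutive zero          = refl
partner-involutive (suc zero)    = refl
partner-involutive (suc (suc i)) = cong (suc ∘ suc) (partner-involutive i)

partner-injective : ∀ {i j} → partner i ≡ partner j → i ≡ j
partner-injective {i} {j} e =
  trans (sym (partner-involutive i)) (trans (cong partner e) (partner-involutive j))

partner-≢ : ∀ i → partner i ≢ i
partner-≢ zero          ()
partner-≢ (suc zero)    ()
partner-≢ (suc (suc i)) e = partner-≢ i (ℕP.suc-injective (ℕP.suc-injective e))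

partner-< : ∀ n c → c < 2 * n → partner c < 2 * n
partner-< zero    c ()
partner-< (suc n) c c<2+2n rewrite ℕP.*-suc 2 n = below c c<2+2n
  where
  below : ∀ c → c < 2 + 2 * n → partner c < 2 + 2 * n
  below zero          _                    = s≤s (s≤s z≤n)
  below (suc zero)    _                    = s≤s z≤n
  below (suc (suc c)) (s≤s (s≤s c<2n)) = s≤s (s≤s (partner-< n c c<2n))

<ᵇ-partnerˡ : ∀ t c → t ≢ c → t ≢ partner c → (t <ᵇ c) ≡ (t <ᵇ partner c)
<ᵇ-partnerˡ zero          zero          t≢c _    = ⊥-elim (t≢c refl)
<ᵇ-partnerˡ zero          (suc zero)    _   t≢pc = ⊥-elim (t≢pc refl)
<ᵇ-partnerˡ zero          (suc (suc c)) _   _    = refl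
<ᵇ-partnerˡ (suc zero)    zero          _   t≢pc = ⊥-elim (t≢pc refl)
<ᵇ-partnerˡ (suc zero)    (suc zero)    t≢c _    = ⊥-elim (t≢c refl)
<ᵇ-partnerˡ (suc zero)    (suc (suc c)) _   _    = refl
<ᵇ-partnerˡ (suc (suc t)) zero          _   _    = refl
<ᵇ-partnerˡ (suc (suc t)) (suc zero)    _   _    = refl
<ᵇ-partnerˡ (suc (suc t)) (suc (suc c)) t≢c t≢pc =
  <ᵇ-partnerˡ t c (t≢c ∘ cong (suc ∘ suc)) (t≢pc ∘ cong (suc ∘ suc))

<ᵇ-partnerʳ : ∀ t c → t ≢ c → t ≢ partner c → (c <ᵇ t) ≡ (partner c <ᵇ t)
<ᵇ-partnerʳ t c t≢c t≢pc = begin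
  c <ᵇ t                ≡⟨ <ᵇ-asym (t≢c ∘ sym) ⟩
  not (t <ᵇ c)          ≡⟨ cong not (<ᵇ-partnerˡ t c t≢c t≢pc) ⟩
  not (t <ᵇ partner c)  ≡⟨ <ᵇ-asym (t≢pc ∘ sym) ⟨
  partner c <ᵇ t        ∎
  where open ≡-Reasoning

inPair : ℕ → ℕ → Bool
inPair c i = (i ≡ᵇ c) ∨ (i ≡ᵇ partner c)

bothInPair : ℕ → ℕ → ℕ → Bool
bothInPair c i j = inPair c i ∧ inPair c j

swap : ℕ → ℕ → ℕ
swap c i = if i ≡ᵇ c then partner c else if i ≡ᵇ partner c then c else i

data PairView (c i : ℕ) : Set where
  at-c       : i ≡ c → PairView c i
  at-partner : i ≡ partner c → PairView c i
  outside    : i ≢ c → i ≢ partner c → PairView c i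

pairView : ∀ c i → PairView c i
pairView c i with i ℕ.≟ c | i ℕ.≟ partner c
... | yes i≡c | _        = at-c i≡c
... | no _    | yes i≡pc = at-partner i≡pc
... | no i≢c  | no i≢pc  = outside i≢c i≢pc

module _ (c : ℕ) where

  swap-c : swap c c ≡ partner c
  swap-c rewrite ≡ᵇ-true {c} refl = refl

  swap-partner : swap c (partner c) ≡ c
  swap-partner rewrite ≡ᵇ-false (partner-≢ c) | ≡ᵇ-true {partner c} refl = refl

  swap-outside : ∀ {i} → i ≢ c → i ≢ partner c → swap c i ≡ i
  swap-outside i≢c i≢pc rewrite ≡ᵇ-false i≢c | ≡ᵇ-false i≢pc = refl

  inPair-c : inPair c c ≡ true
  inPair-c rewrite ≡ᵇ-true {c} refl = refl

  inPair-partner : inPair c (partner c) ≡ true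
  inPair-partner rewrite ≡ᵇ-false (partner-≢ c) | ≡ᵇ-true {partner c} refl = refl

  inPair-outside : ∀ {i} → i ≢ c → i ≢ partner c → inPair c i ≡ false
  inPair-outside i≢c i≢pc rewrite ≡ᵇ-false i≢c | ≡ᵇ-false i≢pc = refl

  inPair⇒≡partner : ∀ {i} → inPair c i ≡ true → i ≢ c → i ≡ partner c
  inPair⇒≡partner {i} i∈pair i≢c with pairView c i
  ... | at-c i≡c           = ⊥-elim (i≢c i≡c)
  ... | at-partner i≡pc    = i≡pc
  ... | outside i≢c′ i≢pc  = case trans (sym i∈pair) (inPair-outside i≢c′ i≢pc) of λ ()

  swap-∉pair : ∀ {i} → inPair c i ≡ false → swap c i ≡ i
  swap-∉pair {i} i∉pair with pairView c i
  ... | at-c refl         = case trans (sym i∉pair) inPair-c of λ ()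
  ... | at-partner refl   = case trans (sym i∉pair) inPair-partner of λ ()
  ... | outside i≢c i≢pc  = swap-outside i≢c i≢pc

  swap-involutive : ∀ i → swap c (swap c i) ≡ i
  swap-involutive i with pairView c i
  ... | at-c refl           rewrite swap-c        = swap-partner
  ... | at-partner refl     rewrite swap-partner  = swap-c
  ... | outside i≢c i≢pc    rewrite swap-outside i≢c i≢pc = swap-outside i≢c i≢pc

  swap-injective : ∀ {i j} → swap c i ≡ swap c j → i ≡ j
  swap-injective {i} {j} e = trans (sym (swap-involutive i)) (trans (cong (swap c) e) (swap-involutive j))

  swap-< : ∀ {m i} → c < m → partner c < m → i < m → swap c i < m
  swap-< {i = i} c<m pc<m i<m with pairView c i
  ... | at-c refl         rewrite swap-c       = pc<m
  ... | at-partner refl   rewrite swap-partner = c<m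
  ... | outside i≢c i≢pc  rewrite swap-outside i≢c i≢pc = i<m

  swap-≡ᵇ-c : ∀ i → (swap c i ≡ᵇ c) ≡ (i ≡ᵇ partner c)
  swap-≡ᵇ-c i with pairView c i
  ... | at-c refl rewrite swap-c = trans (≡ᵇ-false (partner-≢ c)) (sym (≡ᵇ-false (partner-≢ c ∘ sym)))
  ... | at-partner refl rewrite swap-partner | ≡ᵇ-true {c} refl | ≡ᵇ-true {partner c} refl = refl
  ... | outside i≢c i≢pc rewrite swap-outside i≢c i≢pc | ≡ᵇ-false i≢c | ≡ᵇ-false i≢pc = refl

  swap-<ᵇ : ∀ {i j} → i ≢ j → (swap c i <ᵇ swap c j) ≡ bothInPair c i j xor (i <ᵇ j)
  swap-<ᵇ {i} {j} i≢j with pairView c i | pairView c j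
  ... | at-c refl       | at-c refl       = ⊥-elim (i≢j refl)
  ... | at-partner refl | at-partner refl = ⊥-elim (i≢j refl)
  ... | at-c refl       | at-partner refl
    rewrite swap-c | swap-partner | inPair-c | inPair-partner = <ᵇ-asym (partner-≢ c)
  ... | at-partner refl | at-c refl
    rewrite swap-c | swap-partner | inPair-c | inPair-partner = <ᵇ-asym (partner-≢ c ∘ sym)
  ... | at-c refl       | outside j≢c j≢pc
    rewrite swap-c | swap-outside j≢c j≢pc | inPair-outside j≢c j≢pc | ∧-zeroʳ (inPair c c) =
    sym (<ᵇ-partnerʳ j c j≢c j≢pc)
  ... | at-partner refl | outside j≢c j≢pc
    rewrite swap-partner | swap-outside j≢c j≢pc | inPair-outside j≢c j≢pc | ∧-zeroʳ (inPair c (partner c)) =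
    <ᵇ-partnerʳ j c j≢c j≢pc
  ... | outside i≢c i≢pc | at-c refl
    rewrite swap-c | swap-outside i≢c i≢pc | inPair-outside i≢c i≢pc = sym (<ᵇ-partnerˡ i c i≢c i≢pc)
  ... | outside i≢c i≢pc | at-partner refl
    rewrite swap-partner | swap-outside i≢c i≢pc | inPair-outside i≢c i≢pc = <ᵇ-partnerˡ i c i≢c i≢pc
  ... | outside i≢c i≢pc | outside j≢c j≢pc
    rewrite swap-outside i≢c i≢pc | swap-outside j≢c j≢pc | inPair-outside i≢c i≢pc = refl

swap-partner-≗ : ∀ c i → swap (partner c) i ≡ swap c i
swap-partner-≗ c i with pairView c i
... | at-c refl rewrite swap-c c =
  trans (cong (swap (partner c)) (sym (partner-involutive c))) (swap-partner (partner c))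
... | at-partner refl rewrite swap-partner c = trans (swap-c (partner c)) (partner-involutive c)
... | outside i≢c i≢pc rewrite swap-outside c i≢c i≢pc =
  swap-outside (partner c) i≢pc (i≢c ∘ flip trans (partner-involutive c))

swap-partner-inverse : ∀ c i → swap (partner c) (swap c i) ≡ i
swap-partner-inverse c i = trans (swap-partner-≗ c (swap c i)) (swap-involutive c i)

memᵇ : ℕ → List ℕ → Bool
memᵇ a = any (_≡ᵇ a)

∈⇒memᵇ : ∀ {a is} → a ∈ is → memᵇ a is ≡ true
∈⇒memᵇ {a} (here refl) rewrite ≡ᵇ-true {a} refl = refl
∈⇒memᵇ {a} {i ∷ _} (there a∈is) rewrite ∈⇒memᵇ a∈is = ∨-zeroʳ (i ≡ᵇ a)

∉⇒memᵇ : ∀ {a is} → All (a ≢_) is → memᵇ a is ≡ false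
∉⇒memᵇ []           = refl
∉⇒memᵇ (a≢i ∷ a∉is) rewrite ≡ᵇ-false (a≢i ∘ sym) = ∉⇒memᵇ a∉is

module _ (c : ℕ) where

  parity-inPair : ∀ {is} → Unique is →
    oddᵇ (countᵇ (inPair c) is) ≡ memᵇ c is xor memᵇ (partner c) is ×
    oddᵇ (pairCount (bothInPair c) is) ≡ memᵇ c is ∧ memᵇ (partner c) is
  parity-inPair {[]} _ = refl , refl
  parity-inPair {i ∷ is} (i∉is ∷ u) with parity-inPair u | pairView c i
  ... | count , pairs | at-c refl
    rewrite inPair-c c | ≡ᵇ-true {c} refl | ≡ᵇ-false (partner-≢ c ∘ sym) | ∉⇒memᵇ i∉is
          | oddᵇ-+ (countᵇ (inPair c) is) (pairCount (bothInPair c) is) | count | pairs =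
    refl , xor-identityʳ (memᵇ (partner c) is)
  ... | count , pairs | at-partner refl
    rewrite inPair-partner c | ≡ᵇ-true {partner c} refl | ≡ᵇ-false (partner-≢ c) | ∉⇒memᵇ i∉is
          | oddᵇ-+ (countᵇ (inPair c) is) (pairCount (bothInPair c) is) | count | pairs
          | xor-identityʳ (memᵇ c is) | ∧-zeroʳ (memᵇ c is) | ∧-identityʳ (memᵇ c is) =
    xor-comm true (memᵇ c is) , xor-identityʳ (memᵇ c is)
  ... | count , pairs | outside i≢c i≢pc
    rewrite inPair-outside c i≢c i≢pc | ≡ᵇ-false i≢c | ≡ᵇ-false i≢pc
          | oddᵇ-+ (countᵇ (λ _ → false) is) (pairCount (bothInPair c) is) | pairs | count =
    refl , cong (_xor (memᵇ c is ∧ memᵇ (partner c) is)) (oddᵇ-countᵇ-false is)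
    where
    oddᵇ-countᵇ-false : ∀ (xs : List ℕ) → oddᵇ (countᵇ (λ _ → false) xs) ≡ false
    oddᵇ-countᵇ-false []       = refl
    oddᵇ-countᵇ-false (_ ∷ xs) = oddᵇ-countᵇ-false xs

  parity-bothInPair : ∀ {is} → Unique is → c ∈ is → partner c ∈ is → oddᵇ (pairCount (bothInPair c) is) ≡ true
  parity-bothInPair u c∈is pc∈is rewrite proj₂ (parity-inPair u) | ∈⇒memᵇ c∈is | ∈⇒memᵇ pc∈is = refl

-- idx x = ∣x∣ - 1, so partner pairs the absolute values 2j-1 and 2j; + 0 is not a letter.
idx : ℤ → ℕ
idx (+ zero)  = 0
idx (+ suc i) = i
idx -[1+ i ]  = i

data Letter (m : ℕ) : ℤ → Set where
  pos : ∀ {i} → i < m → Letter m (+ suc i)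
  neg : ∀ {i} → i < m → Letter m -[1+ i ]

idx<m : ∀ {m x} → Letter m x → idx x < m
idx<m (pos i<m) = i<m
idx<m (neg i<m) = i<m

swapAbs : ℕ → ℤ → ℤ
swapAbs c (+ zero)  = + zero
swapAbs c (+ suc i) = + suc (swap c i)
swapAbs c -[1+ i ]  = -[1+ swap c i ]

sameSign : ℤ → ℤ → Bool
sameSign x y = not (isNeg x xor isNeg y)

module _ (c : ℕ) where

  isNeg-swapAbs : ∀ x → isNeg (swapAbs c x) ≡ isNeg x
  isNeg-swapAbs (+ zero)  = refl
  isNeg-swapAbs (+ suc _) = refl
  isNeg-swapAbs -[1+ _ ]  = refl

  sameSign-swapAbs : ∀ x y → sameSign (swapAbs c x) (swapAbs c y) ≡ sameSign x y
  sameSign-swapAbs x y rewrite isNeg-swapAbs x | isNeg-swapAbs y = refl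

  idx-swapAbs : ∀ {m x} → Letter m x → idx (swapAbs c x) ≡ swap c (idx x)
  idx-swapAbs (pos _) = refl
  idx-swapAbs (neg _) = refl

  Letter-swapAbs : ∀ {m x} → c < m → partner c < m → Letter m x → Letter m (swapAbs c x)
  Letter-swapAbs c<m pc<m (pos i<m) = pos (swap-< c c<m pc<m i<m)
  Letter-swapAbs c<m pc<m (neg i<m) = neg (swap-< c c<m pc<m i<m)

  swapAbs-outside : ∀ x → inPair c (idx x) ≡ false → swapAbs c x ≡ x
  swapAbs-outside (+ zero)  _ = refl
  swapAbs-outside (+ suc i) i∉pair = cong (+_ ∘ suc) (swap-∉pair c i∉pair)
  swapAbs-outside -[1+ i ]  i∉pair = cong -[1+_] (swap-∉pair c i∉pair)

swapAbs-partner-inverse : ∀ c x → swapAbs (partner c) (swapAbs c x) ≡ x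
swapAbs-partner-inverse c (+ zero)  = refl
swapAbs-partner-inverse c (+ suc i) = cong (+_ ∘ suc) (swap-partner-inverse c i)
swapAbs-partner-inverse c -[1+ i ]  = cong -[1+_] (swap-partner-inverse c i)

N₁-swapAbs : ∀ c w → N₁ (map (swapAbs c) w) ≡ N₁ w
N₁-swapAbs c w = trans (countᵇ-map (swapAbs c) isNeg w) (countᵇ-cong (All.universal (isNeg-swapAbs c) w))

-- Parity of the Coxeter length

invN₂Bit : ℤ → ℤ → Bool
invN₂Bit x y = (y <ℤᵇ x) xor isNeg (x ℤ.+ y)

inv≡pairCount : ∀ w → inv w ≡ pairCount (λ x y → y <ℤᵇ x) w
inv≡pairCount []       = refl
inv≡pairCount (x ∷ xs) = cong (λ n → countᵇ (λ y → y <ℤᵇ x) xs + n) (inv≡pairCount xs)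

N₂≡pairCount : ∀ w → N₂ w ≡ pairCount (λ x y → isNeg (x ℤ.+ y)) w
N₂≡pairCount []       = refl
N₂≡pairCount (x ∷ xs) = cong (λ n → countᵇ (λ y → isNeg (x ℤ.+ y)) xs + n) (N₂≡pairCount xs)

invN₂Bit-swapAbs : ∀ c {m x y} → Letter m x → Letter m y → idx x ≢ idx y →
  invN₂Bit (swapAbs c x) (swapAbs c y) ≡ bothInPair c (idx x) (idx y) xor invN₂Bit x y
invN₂Bit-swapAbs c (pos {i} _) (pos {j} _) i≢j
  rewrite not-<ᵇ-suc (swap c i) (swap c j) | not-<ᵇ-suc i j
        | swap-<ᵇ c (i≢j ∘ sym) | ∧-comm (inPair c j) (inPair c i) =
  xor-assoc (bothInPair c i j) (j <ᵇ i) false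
invN₂Bit-swapAbs c (neg {i} _) (neg {j} _) i≢j
  rewrite not-≤ᵇ (swap c j) (swap c i) | not-≤ᵇ j i | swap-<ᵇ c i≢j =
  xor-assoc (bothInPair c i j) (i <ᵇ j) true
invN₂Bit-swapAbs c (pos {i} _) (neg {j} _) i≢j
  rewrite isNeg-⊖ (suc (swap c i)) (suc (swap c j)) | isNeg-⊖ (suc i) (suc j) | swap-<ᵇ c i≢j =
  ⊕.x∙yz≈y∙xz true (bothInPair c i j) (i <ᵇ j)
invN₂Bit-swapAbs c (neg {i} _) (pos {j} _) i≢j
  rewrite isNeg-⊖ (suc (swap c j)) (suc (swap c i)) | isNeg-⊖ (suc j) (suc i)
        | swap-<ᵇ c (i≢j ∘ sym) | ∧-comm (inPair c j) (inPair c i) = refl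

oddᵇ-ℓB : ∀ w → oddᵇ (ℓB w) ≡ oddᵇ (pairCount invN₂Bit w) xor oddᵇ (N₁ w)
oddᵇ-ℓB w = begin
  oddᵇ (inv w + N₁ w + N₂ w)                  ≡⟨ oddᵇ-+ (inv w + N₁ w) (N₂ w) ⟩
  oddᵇ (inv w + N₁ w) xor oddᵇ (N₂ w)         ≡⟨ cong (_xor oddᵇ (N₂ w)) (oddᵇ-+ (inv w) (N₁ w)) ⟩
  (oddᵇ (inv w) xor oddᵇ (N₁ w)) xor oddᵇ (N₂ w)
    ≡⟨ ⊕.xy∙z≈xz∙y (oddᵇ (inv w)) (oddᵇ (N₁ w)) (oddᵇ (N₂ w)) ⟩
  (oddᵇ (inv w) xor oddᵇ (N₂ w)) xor oddᵇ (N₁ w)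
    ≡⟨ cong (_xor oddᵇ (N₁ w)) (cong₂ (λ a b → oddᵇ a xor oddᵇ b) (inv≡pairCount w) (N₂≡pairCount w)) ⟩
  (oddᵇ (pairCount (λ x y → y <ℤᵇ x) w) xor oddᵇ (pairCount (λ x y → isNeg (x ℤ.+ y)) w)) xor oddᵇ (N₁ w)
    ≡⟨ cong (_xor oddᵇ (N₁ w)) (oddᵇ-pairCount-xor (λ x y → y <ℤᵇ x) (λ x y → isNeg (x ℤ.+ y)) w) ⟨
  oddᵇ (pairCount invN₂Bit w) xor oddᵇ (N₁ w) ∎
  where open ≡-Reasoning

oddᵇ-ℓB-swapAbs : ∀ {m c w} → All (Letter m) w → Unique (map idx w) → c ∈ map idx w → partner c ∈ map idx w →
  oddᵇ (ℓB (map (swapAbs c) w)) ≡ not (oddᵇ (ℓB w))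
oddᵇ-ℓB-swapAbs {m} {c} {w} letters distinct c∈w pc∈w = begin
  oddᵇ (ℓB (map (swapAbs c) w))
    ≡⟨ oddᵇ-ℓB (map (swapAbs c) w) ⟩
  oddᵇ (pairCount invN₂Bit (map (swapAbs c) w)) xor oddᵇ (N₁ (map (swapAbs c) w))
    ≡⟨ cong₂ (λ k n → oddᵇ k xor oddᵇ n) invN₂-count (N₁-swapAbs c w) ⟩
  oddᵇ (pairCount (λ x y → both x y xor invN₂Bit x y) w) xor oddᵇ (N₁ w)
    ≡⟨ cong (_xor oddᵇ (N₁ w)) (oddᵇ-pairCount-xor both invN₂Bit w) ⟩
  (oddᵇ (pairCount both w) xor oddᵇ (pairCount invN₂Bit w)) xor oddᵇ (N₁ w)
    ≡⟨ cong (λ b → (b xor oddᵇ (pairCount invN₂Bit w)) xor oddᵇ (N₁ w)) both-odd ⟩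
  not (oddᵇ (pairCount invN₂Bit w)) xor oddᵇ (N₁ w)
    ≡⟨ not-distribˡ-xor (oddᵇ (pairCount invN₂Bit w)) (oddᵇ (N₁ w)) ⟨
  not (oddᵇ (pairCount invN₂Bit w) xor oddᵇ (N₁ w))
    ≡⟨ cong not (oddᵇ-ℓB w) ⟨
  not (oddᵇ (ℓB w)) ∎
  where
  open ≡-Reasoning
  both : ℤ → ℤ → Bool
  both x y = bothInPair c (idx x) (idx y)
  invN₂-count : pairCount invN₂Bit (map (swapAbs c) w) ≡ pairCount (λ x y → both x y xor invN₂Bit x y) w
  invN₂-count = trans (pairCount-map (swapAbs c) invN₂Bit w)
                      (pairCount-cong letters (AllPairs.map⁻ distinct) (invN₂Bit-swapAbs c))
  both-odd : oddᵇ (pairCount both w) ≡ true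
  both-odd = trans (cong oddᵇ (sym (pairCount-map idx (bothInPair c) w)))
                   (parity-bothInPair c distinct c∈w pc∈w)

succᵇ-letters : ∀ {m x y} → Letter m x → Letter m y →
  succᵇ m x y ≡ (if sameSign x y then idx y <ᵇ idx x else isNeg y)
succᵇ-letters {m} (pos {i} _)   (pos {j} _)   = +-<ᵇ m (suc j) (suc i)
succᵇ-letters     (neg _)       (neg _)       = refl
succᵇ-letters {m} (pos {i} _)   (neg {j} j<m) = <ᵇ-true (ℕP.≤-<-trans j<m (ℕP.m<m+n m z<s))
succᵇ-letters {m} (neg {i} i<m) (pos {j} _)   = <ᵇ-false (ℕP.≤-trans i<m (ℕP.m≤m+n m (suc j)))

record Compatible (c : ℕ) (u v : ℤ) : Set where
  constructor compatible
  field
    idx-≢        : idx u ≢ idx v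
    ¬bothInPair  : sameSign u v ≡ true → bothInPair c (idx u) (idx v) ≡ false

succᵇ-swapAbs : ∀ {m c u v} → c < m → partner c < m → Letter m u → Letter m v → Compatible c u v →
  succᵇ m (swapAbs c u) (swapAbs c v) ≡ succᵇ m u v
succᵇ-swapAbs {m} {c} {u} {v} c<m pc<m lu lv (compatible u≢v ¬both)
  rewrite succᵇ-letters (Letter-swapAbs c c<m pc<m lu) (Letter-swapAbs c c<m pc<m lv) | succᵇ-letters lu lv
        | sameSign-swapAbs c u v | isNeg-swapAbs c v
  with sameSign u v
... | false = refl
... | true rewrite idx-swapAbs c lu | idx-swapAbs c lv | swap-<ᵇ c (u≢v ∘ sym)
                 | ∧-comm (inPair c (idx v)) (inPair c (idx u)) | ¬both refl = refl

majFrom-cong : ∀ {P : ℤ → Set} {R : ℤ → ℤ → Set} m f p {w} → All P w → Linked R w →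
  (∀ {x y} → P x → P y → R x y → succᵇ m (f x) (f y) ≡ succᵇ m x y) → majFrom m p (map f w) ≡ majFrom m p w
majFrom-cong m f p {[]}     _                 _          _  = refl
majFrom-cong m f p {_ ∷ []} _                 _          _  = refl
majFrom-cong m f p {_ ∷ _ ∷ _} (px ∷ py ∷ ps) (rxy ∷ rs) eq =
  cong₂ (λ b k → (if b then p else 0) + k) (eq px py rxy) (majFrom-cong m f (suc p) (py ∷ ps) rs eq)

fmaj-swapAbs : ∀ {m c w} → c < m → partner c < m → All (Letter m) w → Linked (Compatible c) w →
  fmaj m (map (swapAbs c) w) ≡ fmaj m w
fmaj-swapAbs {m} {c} {w} c<m pc<m letters compat =
  cong₂ (λ a b → 2 * a + b) (majFrom-cong m (swapAbs c) 1 letters compat (succᵇ-swapAbs c<m pc<m))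
                            (N₁-swapAbs c w)

-- Dominoes

domino : ℤ → ℤ → Bool
domino x y = sameSign x y ∧ (idx y ≡ᵇ partner (idx x))

firstNonDomino : List ℤ → Maybe ℕ
firstNonDomino []          = nothing
firstNonDomino (x ∷ [])    = just (idx x)
firstNonDomino (x ∷ y ∷ r) = if domino x y then firstNonDomino r else just (idx x)

dominoInvolution : List ℤ → List ℤ
dominoInvolution w = maybe′ (λ c → map (swapAbs c) w) w (firstNonDomino w)

firstNonDomino-nothing⇒N₁-even : ∀ w → firstNonDomino w ≡ nothing → oddᵇ (N₁ w) ≡ false
firstNonDomino-nothing⇒N₁-even []          _ = refl
firstNonDomino-nothing⇒N₁-even (x ∷ [])    ()
firstNonDomino-nothing⇒N₁-even (x ∷ y ∷ r) e with domino x y in d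
... | false = case e of λ ()
... | true  = begin
  oddᵇ (N₁ (x ∷ y ∷ r))                          ≡⟨ oddᵇ-countᵇ-∷ isNeg x (y ∷ r) ⟩
  isNeg x xor oddᵇ (N₁ (y ∷ r))                  ≡⟨ cong (isNeg x xor_) (oddᵇ-countᵇ-∷ isNeg y r) ⟩
  isNeg x xor (isNeg y xor oddᵇ (N₁ r))          ≡⟨ xor-assoc (isNeg x) (isNeg y) (oddᵇ (N₁ r)) ⟨
  (isNeg x xor isNeg y) xor oddᵇ (N₁ r)          ≡⟨ cong (_xor oddᵇ (N₁ r)) x±y-same ⟩
  oddᵇ (N₁ r)                                    ≡⟨ firstNonDomino-nothing⇒N₁-even r e ⟩
  false                                          ∎
  where
  open ≡-Reasoning
  x±y-same : isNeg x xor isNeg y ≡ false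
  x±y-same = trans (sym (not-involutive _)) (cong not (∧-conicalˡ (sameSign x y) _ d))

firstNonDomino-∈ : ∀ {c} w → firstNonDomino w ≡ just c → c ∈ map idx w
firstNonDomino-∈ (x ∷ [])    refl = here refl
firstNonDomino-∈ (x ∷ y ∷ r) e with domino x y
... | true            = there (there (firstNonDomino-∈ r e))
firstNonDomino-∈ (x ∷ y ∷ r) refl | false = here refl

domino-avoids-pair : ∀ {c} x y r → domino x y ≡ true → firstNonDomino r ≡ just c →
  All (idx x ≢_) (map idx r) → All (idx y ≢_) (map idx r) →
  inPair c (idx x) ≡ false × inPair c (idx y) ≡ false
domino-avoids-pair {c} x y r d e x∉r y∉r =
  inPair-outside c x≢c x≢pc , inPair-outside c y≢c y≢pc
  where
  c∈r = firstNonDomino-∈ r e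
  y≡px : idx y ≡ partner (idx x)
  y≡px = ℕP.≡ᵇ⇒≡ (idx y) (partner (idx x)) (subst T (sym (∧-conicalʳ (sameSign x y) _ d)) _)
  x≢c : idx x ≢ c
  x≢c = All.lookup x∉r c∈r
  y≢c : idx y ≢ c
  y≢c = All.lookup y∉r c∈r
  x≢pc : idx x ≢ partner c
  x≢pc x≡pc = y≢c (trans y≡px (trans (cong partner x≡pc) (partner-involutive c)))
  y≢pc : idx y ≢ partner c
  y≢pc y≡pc = x≢c (partner-injective (trans (sym y≡px) y≡pc))

compatible-outsideˡ : ∀ {c u v} → inPair c (idx u) ≡ false → idx u ≢ idx v → Compatible c u v
compatible-outsideˡ u∉pair u≢v = compatible u≢v λ _ → cong (_∧ _) u∉pair

compatible-avoiding : ∀ {c u v} → c ≢ idx u → c ≢ idx v → idx u ≢ idx v → Compatible c u v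
compatible-avoiding {c} {u} {v} c≢u c≢v u≢v = compatible u≢v λ _ → not-both
  where
  not-both : bothInPair c (idx u) (idx v) ≡ false
  not-both with inPair c (idx u) in u∈pair | inPair c (idx v) in v∈pair
  ... | false | _     = refl
  ... | true  | false = refl
  ... | true  | true  =
    ⊥-elim (u≢v (trans (inPair⇒≡partner c u∈pair (c≢u ∘ sym)) (sym (inPair⇒≡partner c v∈pair (c≢v ∘ sym)))))

Linked-compatible-avoiding : ∀ {c} ws → Unique (map idx ws) → All (c ≢_) (map idx ws) → Linked (Compatible c) ws
Linked-compatible-avoiding []          _                   _                   = []
Linked-compatible-avoiding (_ ∷ [])    _                   _                   = [-]
Linked-compatible-avoiding (u ∷ v ∷ r) ((u≢v ∷ _) ∷ u-rest) (c≢u ∷ c≢v ∷ c∉r) =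
  compatible-avoiding c≢u c≢v u≢v ∷ Linked-compatible-avoiding (v ∷ r) u-rest (c≢v ∷ c∉r)

Linked-∷-outside : ∀ {c y} {r} → inPair c (idx y) ≡ false → All (idx y ≢_) (map idx r) →
  Linked (Compatible c) r → Linked (Compatible c) (y ∷ r)
Linked-∷-outside {r = []}    _      _         _ = [-]
Linked-∷-outside {r = _ ∷ _} y∉pair (y≢z ∷ _) l = compatible-outsideˡ y∉pair y≢z ∷ l

firstNonDomino-compatible : ∀ {c} w → firstNonDomino w ≡ just c → Unique (map idx w) → Linked (Compatible c) w
firstNonDomino-compatible (x ∷ [])    _ _ = [-]
firstNonDomino-compatible (x ∷ y ∷ r) e ((x≢y ∷ x∉r) ∷ (y∉r ∷ u)) with domino x y in d
firstNonDomino-compatible (x ∷ y ∷ r) refl ((x≢y ∷ x∉r) ∷ y-rest) | false =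
  compatible x≢y not-partner ∷ Linked-compatible-avoiding (y ∷ r) y-rest (x≢y ∷ x∉r)
  where
  not-partner : sameSign x y ≡ true → bothInPair (idx x) (idx x) (idx y) ≡ false
  not-partner same with inPair (idx x) (idx y) in y∈pair
  ... | false = ∧-zeroʳ _
  ... | true  =
    case trans (sym d) (cong₂ _∧_ same (≡ᵇ-true (inPair⇒≡partner (idx x) y∈pair (x≢y ∘ sym)))) of λ ()
... | true with x∉pair , y∉pair ← domino-avoids-pair x y r d e x∉r y∉r =
  compatible-outsideˡ x∉pair x≢y ∷ Linked-∷-outside y∉pair y∉r (firstNonDomino-compatible r e u)

firstNonDomino-swapAbs : ∀ {m c} w → firstNonDomino w ≡ just c → Unique (map idx w) → All (Letter m) w →
  firstNonDomino (map (swapAbs c) w) ≡ just (partner c)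
firstNonDomino-swapAbs (x ∷ [])    refl _ (lx ∷ []) =
  cong just (trans (idx-swapAbs (idx x) lx) (swap-c (idx x)))
firstNonDomino-swapAbs (x ∷ y ∷ r) e ((_ ∷ x∉r) ∷ (y∉r ∷ u)) (lx ∷ ly ∷ lr) with domino x y in d
firstNonDomino-swapAbs (x ∷ y ∷ r) refl _ (lx ∷ ly ∷ _) | false
  rewrite sameSign-swapAbs (idx x) x y | idx-swapAbs (idx x) lx | idx-swapAbs (idx x) ly | swap-c (idx x)
        | partner-involutive (idx x) | swap-≡ᵇ-c (idx x) (idx y) | d = refl
firstNonDomino-swapAbs {c = c} (x ∷ y ∷ r) e ((_ ∷ x∉r) ∷ (y∉r ∷ u)) (lx ∷ ly ∷ lr) | true
  with x∉pair , y∉pair ← domino-avoids-pair x y r d e x∉r y∉r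
  rewrite swapAbs-outside c x x∉pair | swapAbs-outside c y y∉pair | d = firstNonDomino-swapAbs r e u lr

words-suc : ∀ k (xs : List ℤ) → words (suc k) xs ≡ cartesianProductWith _∷_ xs (words k xs)
words-suc k xs = concatMap≡cartesianProductWith _∷_ xs (words k xs)

∈-words⁻ : ∀ k {xs w} → w ∈ words k xs → length w ≡ k × All (_∈ xs) w
∈-words⁻ zero    (here refl) = refl , []
∈-words⁻ (suc k) {xs} {w} w∈
  with x , v , x∈xs , v∈words , refl ←
         ∈-cartesianProductWith⁻ _∷_ xs (words k xs) (subst (w ∈_) (words-suc k xs) w∈)
  with length≡ , v⊆xs ← ∈-words⁻ k v∈words = cong suc length≡ , x∈xs ∷ v⊆xs

∈-words⁺ : ∀ k {xs w} → length w ≡ k → All (_∈ xs) w → w ∈ words k xs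
∈-words⁺ zero    {w = []}    refl []             = here refl
∈-words⁺ (suc k) {xs} {x ∷ w} len  (x∈xs ∷ w⊆xs) =
  subst (x ∷ w ∈_) (sym (words-suc k xs))
    (∈-cartesianProductWith⁺ _∷_ x∈xs (∈-words⁺ k (ℕP.suc-injective len) w⊆xs))

Unique-words : ∀ k {xs : List ℤ} → Unique xs → Unique (words k xs)
Unique-words zero    _ = [] ∷ []
Unique-words (suc k) {xs} u =
  subst Unique (sym (words-suc k xs)) (Unique.cartesianProductWith⁺ _∷_ ∷-injective u (Unique-words k u))

Unique-entries : ∀ m → Unique (entries m)
Unique-entries m =
  Unique.++⁺ (Unique.map⁺ ℤP.-[1+-injective (Unique.upTo⁺ m)) (Unique.map⁺ ℤP.+[1+-injective (Unique.upTo⁺ m))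
    λ (neg∈ , pos∈) → case ∈-map⁻ -[1+_] neg∈ , ∈-map⁻ (+_ ∘ suc) pos∈ of λ { ((_ , _ , refl) , (_ , _ , ())) }

∈-entries⁻ : ∀ {m x} → x ∈ entries m → Letter m x
∈-entries⁻ {m} x∈ with ∈-++⁻ (map -[1+_] (upTo m)) x∈
... | inj₁ neg∈ with _ , i∈ , refl ← ∈-map⁻ -[1+_] neg∈ = neg (∈-upTo⁻ i∈)
... | inj₂ pos∈ with _ , i∈ , refl ← ∈-map⁻ (+_ ∘ suc) pos∈ = pos (∈-upTo⁻ i∈)

∈-entries⁺ : ∀ {m x} → Letter m x → x ∈ entries m
∈-entries⁺ {m} (pos i<m) = ∈-++⁺ʳ (map -[1+_] (upTo m)) (∈-map⁺ (+_ ∘ suc) (∈-upTo⁺ i<m))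
∈-entries⁺     (neg i<m) = ∈-++⁺ˡ (∈-map⁺ -[1+_] (∈-upTo⁺ i<m))

notIn⇒All≢ : ∀ {a} ys → notIn a ys ≡ true → All (a ≢_) (map ∣_∣ ys)
notIn⇒All≢ []       _ = []
notIn⇒All≢ (y ∷ ys) e =
  (λ a≡y → case trans (sym (∧-conicalˡ _ _ e)) (cong not (≡ᵇ-true a≡y)) of λ ())
  ∷ notIn⇒All≢ ys (∧-conicalʳ _ _ e)

All≢⇒notIn : ∀ {a} ys → All (a ≢_) (map ∣_∣ ys) → notIn a ys ≡ true
All≢⇒notIn []       []           = refl
All≢⇒notIn (y ∷ ys) (a≢y ∷ a∉ys) rewrite ≡ᵇ-false a≢y = All≢⇒notIn ys a∉ys

absDistinct⇒Unique : ∀ w → absDistinct w ≡ true → Unique (map ∣_∣ w)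
absDistinct⇒Unique []      _ = []
absDistinct⇒Unique (x ∷ w) e = notIn⇒All≢ w (∧-conicalˡ _ _ e) ∷ absDistinct⇒Unique w (∧-conicalʳ _ _ e)

Unique⇒absDistinct : ∀ w → Unique (map ∣_∣ w) → absDistinct w ≡ true
Unique⇒absDistinct []      []           = refl
Unique⇒absDistinct (x ∷ w) (x∉w ∷ u) rewrite All≢⇒notIn w x∉w = Unique⇒absDistinct w u

map-∣∣-letters : ∀ {m w} → All (Letter m) w → map ∣_∣ w ≡ map suc (map idx w)
map-∣∣-letters []             = refl
map-∣∣-letters (pos _ ∷ rest) = cong (_ ∷_) (map-∣∣-letters rest)
map-∣∣-letters (neg _ ∷ rest) = cong (_ ∷_) (map-∣∣-letters rest)

record IsSignedPermutation (m : ℕ) (w : List ℤ) : Set where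
  field
    length≡  : length w ≡ m
    letters  : All (Letter m) w
    distinct : Unique (map idx w)

∈B⇒IsSignedPermutation : ∀ {m w} → w ∈ B m → IsSignedPermutation m w
∈B⇒IsSignedPermutation {m} {w} w∈B
  with w∈words , distinctᵇ ← ∈-filter⁻ (T? ∘ absDistinct) w∈B
  with length≡ , w⊆entries ← ∈-words⁻ m w∈words =
  let letters = All.map ∈-entries⁻ w⊆entries in record
  { length≡  = length≡
  ; letters  = letters
  ; distinct = Unique.map⁻ (subst Unique (map-∣∣-letters letters)
                 (absDistinct⇒Unique w (Equivalence.to T-≡ distinctᵇ)))
  }

IsSignedPermutation⇒∈B : ∀ {m w} → IsSignedPermutation m w → w ∈ B m
IsSignedPermutation⇒∈B {m} {w} σ =
  ∈-filter⁺ (T? ∘ absDistinct) (∈-words⁺ m length≡ (All.map ∈-entries⁺ letters))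
    (Equivalence.from T-≡ (Unique⇒absDistinct w (subst Unique (sym (map-∣∣-letters letters))
                                                   (Unique.map⁺ ℕP.suc-injective distinct))))
  where open IsSignedPermutation σ

Unique-B : ∀ m → Unique (B m)
Unique-B m = Unique.filter⁺ (T? ∘ absDistinct) (Unique-words m (Unique-entries m))

IsSignedPermutation-swapAbs : ∀ {m c w} → c < m → partner c < m → IsSignedPermutation m w →
  IsSignedPermutation m (map (swapAbs c) w)
IsSignedPermutation-swapAbs {m} {c} {w} c<m pc<m σ = record
  { length≡  = trans (length-map (swapAbs c) w) length≡
  ; letters  = All.map⁺ (All.map (Letter-swapAbs c c<m pc<m) letters)
  ; distinct = subst Unique (sym idx-swapAbs-map) (Unique.map⁺ (swap-injective c) distinct)
  }
  where
  open IsSignedPermutation σ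
  idx-swapAbs-map : map idx (map (swapAbs c) w) ≡ map (swap c) (map idx w)
  idx-swapAbs-map = trans (sym (map-∘ w)) (trans (map-cong-local (All.map (idx-swapAbs c) letters)) (map-∘ w))

dominoInvolution-on-odd-N₁ : ∀ n {w} → IsSignedPermutation (2 * n) w → oddᵇ (N₁ w) ≡ true →
  IsSignedPermutation (2 * n) (dominoInvolution w) × dominoInvolution (dominoInvolution w) ≡ w ×
  fmaj (2 * n) (dominoInvolution w) ≡ fmaj (2 * n) w × oddᵇ (ℓB (dominoInvolution w)) ≡ not (oddᵇ (ℓB w))
dominoInvolution-on-odd-N₁ n {w} σ N₁-odd with firstNonDomino w in e
... | nothing = case trans (sym N₁-odd) (firstNonDomino-nothing⇒N₁-even w e) of λ ()
... | just c  =
  IsSignedPermutation-swapAbs c<m pc<m σ ,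
  involutive ,
  fmaj-swapAbs c<m pc<m letters (firstNonDomino-compatible w e distinct) ,
  oddᵇ-ℓB-swapAbs letters distinct c∈w pc∈w
  where
  open IsSignedPermutation σ
  indices<m : All (_< 2 * n) (map idx w)
  indices<m = All.map⁺ (All.map idx<m letters)
  c∈w : c ∈ map idx w
  c∈w = firstNonDomino-∈ w e
  c<m : c < 2 * n
  c<m = All.lookup indices<m c∈w
  pc<m : partner c < 2 * n
  pc<m = partner-< n c c<m
  pc∈w : partner c ∈ map idx w
  pc∈w = unique-full⇒∈ distinct indices<m (trans (length-map idx w) length≡) pc<m
  involutive : dominoInvolution (map (swapAbs c) w) ≡ w
  involutive rewrite firstNonDomino-swapAbs w e distinct letters =
    trans (sym (map-∘ w)) (map-id-local (All.universal (swapAbs-partner-inverse c) w))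

lemma3p1 : (n : ℕ) → 1 ≤ n → (k : ℕ) → coeffOddFmaj (2 * n) k ≡ + 0
lemma3p1 n _ k =
  sum≡0-of-sign-reversing-involution (λ w → sgn (ℓB w)) dominoInvolution
    (Unique.filter⁺ (T? ∘ P) (Unique-B (2 * n))) sign-reversing
  where
  P : List ℤ → Bool
  P w = oddᵇ (fmaj (2 * n) w) ∧ (fmaj (2 * n) w ≡ᵇ k)
  sign-reversing : IsSignReversingInvolutionOn (λ w → sgn (ℓB w)) dominoInvolution (filterᵇ P (B (2 * n)))
  sign-reversing {w} w∈
    with w∈B , Pw ← ∈-filter⁻ (T? ∘ P) w∈
    with σ , φφw≡w , fmaj≡ , ℓB-flips ← dominoInvolution-on-odd-N₁ n (∈B⇒IsSignedPermutation w∈B)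
           (trans (sym (oddᵇ-2*+ (maj (2 * n) w) (N₁ w))) (∧-conicalˡ _ _ (Equivalence.to T-≡ Pw))) =
    ∈-filter⁺ (T? ∘ P) (IsSignedPermutation⇒∈B σ) (subst (λ f → T (oddᵇ f ∧ (f ≡ᵇ k))) (sym fmaj≡) Pw) ,
    φφw≡w ,
    sgn-opposite (ℓB (dominoInvolution w)) (ℓB w) ℓB-flips
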